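{- Let $\mathcal{C}$ be a category with symbols and $D:\mathcal{I}\to\mathcal{C}$ a diagram. Assume that for all $(i,x),(j,x)\in\mathrm{Sym}(D)$ (i.e. the same symbol $x$ occurring at nodes $i$ and $j$) there exist $(k,y)\in\mathrm{Sym}(D)$ and arrows $m:k\to i$, $n:k\to j$ in $\mathcal{I}$ such that $|D(m)|(y)=|D(n)|(y)=x$. Then $D$ is name-clash-free. If additionally all edges of $D$ are mapped to inclusions, then $D$ is fully-sharing.
   Context: An inclusive category is a category with a broad subcategory (same objects) that is a partially ordered class, whose morphisms are called inclusions. A category with symbols is a category $\mathcal{C}$ (here inclusive) with an (inclusion-preserving) functor $|\_|:\mathcal{C}\to\mathbf{Set}$. For a diagram $D:\mathcal{I}\to\mathcal{C}$: $\mathrm{Sym}(D)=\{(i,x)\mid i\in|\mathcal{I}|, x\in|D(i)|\}$; $\leq_D$ is the preorder generated by $(i,x)\leq_D(j,|D(m)|(x))$ for every arrow $m:i\to j$ of $\mathcal{I}$; $\sim_D$ is the least equivalence relation containing $\leq_D$. For each equivalence class $X\in\mathrm{Sym}(D)/\sim_D$ let $\mathrm{Nam}(X)=\{x\mid (i,x)\in X\}$. $D$ is name-clash-free if the sets $\mathrm{Nam}(X)$, for distinct classes $X$, are pairwise disjoint; $D$ is fully-sharing if it is name-clash-free and moreover every $\mathrm{Nam}(X)$ has exactly one element. -}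

module Defs where

open import Level using (Level; _⊔_) renaming (suc to lsuc)
open import Data.Product using (Σ; _×_; _,_; ∃-syntax)
open import Relation.Binary.PropositionalEquality using (_≡_)
open import Relation.Binary.Construct.Closure.ReflexiveTransitive using (Star)
open import Relation.Binary.Construct.Closure.Equivalence using (EqClosure)

record Category (o h : Level) : Set (lsuc (o ⊔ h)) where
  infixr 9 _∘_
  field
    Obj : Set o
    Hom : Obj → Obj → Set h
    id  : ∀ {A} → Hom A A
    _∘_ : ∀ {A B C} → Hom B C → Hom A B → Hom A C
    identityˡ : ∀ {A B} (f : Hom A B) → id ∘ f ≡ f
    identityʳ : ∀ {A B} (f : Hom A B) → f ∘ id ≡ f
    assoc : ∀ {A B C E} (f : Hom A B) (g : Hom B C) (k : Hom C E) →
            (k ∘ g) ∘ f ≡ k ∘ (g ∘ f)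

record Functor {o₁ h₁ o₂ h₂ : Level} (I : Category o₁ h₁) (C : Category o₂ h₂)
       : Set (o₁ ⊔ h₁ ⊔ o₂ ⊔ h₂) where
  private
    module I = Category I
    module C = Category C
  field
    F₀ : I.Obj → C.Obj
    F₁ : ∀ {A B} → I.Hom A B → C.Hom (F₀ A) (F₀ B)
    F-id : ∀ {A} → F₁ (I.id {A}) ≡ C.id
    F-∘  : ∀ {A B E} (f : I.Hom A B) (g : I.Hom B E) →
           F₁ (g I.∘ f) ≡ (F₁ g C.∘ F₁ f)

-- Inclusive categories: a broad subcategory (all objects, all identities,
-- closed under composition) which is a partially ordered class, i.e. thin
-- (at most one inclusion between two objects) and antisymmetric.

record InclusiveCategory (o h i : Level) : Set (lsuc (o ⊔ h ⊔ i)) where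
  field
    cat : Category o h
  open Category cat public
  field
    Incl : ∀ {A B} → Hom A B → Set i
    incl-id : ∀ {A} → Incl (id {A})
    incl-∘  : ∀ {A B C} {f : Hom A B} {g : Hom B C} → Incl f → Incl g → Incl (g ∘ f)
    incl-thin : ∀ {A B} {f g : Hom A B} → Incl f → Incl g → f ≡ g
    incl-antisym : ∀ {A B} {f : Hom A B} {g : Hom B A} → Incl f → Incl g → A ≡ B

-- Sets are modelled as subsets of a
-- common type of names `Name` (so that symbols of different objects can be
-- compared, as with material sets): |A| is the predicate `Sy A`, and |f|
-- for f : A → B is (the restriction to |A| of) `sym f : Name → Name`,
-- which maps |A| into |B|.  The functor |_| preserves inclusions: the image
-- of an inclusion is a set-theoretic inclusion, i.e. acts as the identity.

record InclusiveCategoryWithSymbols (o h i n s : Level)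
       : Set (lsuc (o ⊔ h ⊔ i ⊔ n ⊔ s)) where
  field
    icat : InclusiveCategory o h i
  open InclusiveCategory icat public
  field
    Name : Set n
    Sy   : Obj → Name → Set s
    sym  : ∀ {A B} → Hom A B → Name → Name
    sym-mem : ∀ {A B} (f : Hom A B) {x} → Sy A x → Sy B (sym f x)
    sym-id  : ∀ {A} {x} → Sy A x → sym (id {A}) x ≡ x
    sym-∘   : ∀ {A B C} (f : Hom A B) (g : Hom B C) {x} → Sy A x →
              sym (g ∘ f) x ≡ sym g (sym f x)
    sym-incl : ∀ {A B} {f : Hom A B} → Incl f → ∀ {x} → Sy A x → sym f x ≡ x

module DiagramNotions {o h i n s o' h' : Level}
       (C : InclusiveCategoryWithSymbols o h i n s)
       {I : Category o' h'} (D : Functor I (InclusiveCategoryWithSymbols.cat C))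
       where
  open InclusiveCategoryWithSymbols C
  open Functor D
  module I = Category I

  -- Sym(D) = {(i,x) | x ∈ |D(i)|}; we work on pairs (i , x) and carry the
  -- membership proof where needed.
  InSym : I.Obj × Name → Set s
  InSym (j , x) = Sy (F₀ j) x

  data Step : I.Obj × Name → I.Obj × Name → Set (o' ⊔ h' ⊔ n ⊔ s) where
    step : ∀ {j k} (m : I.Hom j k) {x} → Sy (F₀ j) x → Step (j , x) (k , sym (F₁ m) x)

  _≤D_ : I.Obj × Name → I.Obj × Name → Set (o' ⊔ h' ⊔ n ⊔ s)
  _≤D_ = Star Step

  _∼D_ : I.Obj × Name → I.Obj × Name → Set (o' ⊔ h' ⊔ n ⊔ s)
  _∼D_ = EqClosure Step

  -- Name-clash-free: Nam(X) ∩ Nam(Y) = ∅ for distinct classes X ≠ Y.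
  -- Unfolded: whenever the same name x occurs as (j,x) and (k,x) in
  -- Sym(D), these two symbols lie in the same ∼_D-class.
  NameClashFree : Set (o' ⊔ h' ⊔ n ⊔ s)
  NameClashFree = ∀ j k x → Sy (F₀ j) x → Sy (F₀ k) x → (j , x) ∼D (k , x)

  -- Fully sharing: name-clash-free and every Nam(X) is a singleton, i.e.
  -- (classes being nonempty) any two ∼_D-equivalent symbols have the same name.
  FullySharing : Set (o' ⊔ h' ⊔ n ⊔ s)
  FullySharing = NameClashFree ×
    (∀ j k x y → Sy (F₀ j) x → Sy (F₀ k) y → (j , x) ∼D (k , y) → x ≡ y)

  SharedSymbolsHaveCommonSource : Set (o' ⊔ h' ⊔ n ⊔ s)
  SharedSymbolsHaveCommonSource =
    ∀ j k x → Sy (F₀ j) x → Sy (F₀ k) x →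
    ∃[ l ] ∃[ y ] Σ (I.Hom l j) λ m → Σ (I.Hom l k) λ m' →
      Sy (F₀ l) y × sym (F₁ m) y ≡ x × sym (F₁ m') y ≡ x

  AllEdgesInclusions : Set (o' ⊔ h' ⊔ i)
  AllEdgesInclusions = ∀ {j k} (m : I.Hom j k) → Incl (F₁ m)

module Submission where

-- * Name-clash-freeness: if a symbol (l,y) is carried by arrows m : l → j and
--   m' : l → k to (j,x) and (k,x'), then (j,x) ∼_D (l,y) ∼_D (k,x').  The
--   hypothesis provides such a common source for any two occurrences (j,x),
--   (k,x) of the same name x, so they lie in one class.
-- * Full sharing: when every edge is mapped to an inclusion, |D(m)| acts as
--   the identity on |D(j)|, so every generating step keeps the name of the
--   symbol.  The name is then an invariant of ∼_D (a fold of the equivalence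
--   closure into _≡_), i.e. each class has a single name.

open import Defs
open import Level using (Level)
open import Data.Product using (_×_; _,_; proj₂)
open import Relation.Binary.PropositionalEquality as ≡ using (_≡_; subst)
open import Relation.Binary.Construct.Closure.Equivalence
  using (return; transitive; symmetric; gfold)

module SymbolClasses {o h i n s o' h' : Level}
       (C : InclusiveCategoryWithSymbols o h i n s)
       {I : Category o' h'} (D : Functor I (InclusiveCategoryWithSymbols.cat C))
       where
  open InclusiveCategoryWithSymbols C
  open Functor D
  open DiagramNotions C D

  arrow⇒∼D : ∀ {l j} (m : I.Hom l j) {y x} →
             Sy (F₀ l) y → sym (F₁ m) y ≡ x → (l , y) ∼D (j , x)
  arrow⇒∼D m {y} y∈Dl y↦x =
    subst (λ z → (_ , y) ∼D (_ , z)) y↦x (return (step m y∈Dl))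

  commonSource⇒∼D : ∀ {l j k} (m : I.Hom l j) (m' : I.Hom l k) {y x x'} →
                    Sy (F₀ l) y → sym (F₁ m) y ≡ x → sym (F₁ m') y ≡ x' →
                    (j , x) ∼D (k , x')
  commonSource⇒∼D m m' y∈Dl y↦x y↦x' =
    transitive Step (symmetric Step (arrow⇒∼D m y∈Dl y↦x))
                    (arrow⇒∼D m' y∈Dl y↦x')

  nameClashFree : SharedSymbolsHaveCommonSource → NameClashFree
  nameClashFree common j k x x∈Dj x∈Dk
    with common j k x x∈Dj x∈Dk
  ... | l , y , m , m' , y∈Dl , y↦x , y↦x' =
    commonSource⇒∼D m m' y∈Dl y↦x y↦x'

  step-preserves-name : AllEdgesInclusions →
                        ∀ {a b} → Step a b → proj₂ a ≡ proj₂ b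
  step-preserves-name inclusions (step m x∈Dj) =
    ≡.sym (sym-incl (inclusions m) x∈Dj)

  ∼D-preserves-name : AllEdgesInclusions →
                      ∀ {a b} → a ∼D b → proj₂ a ≡ proj₂ b
  ∼D-preserves-name inclusions =
    gfold ≡.isEquivalence proj₂ (step-preserves-name inclusions)

  fullySharing : SharedSymbolsHaveCommonSource → AllEdgesInclusions →
                 FullySharing
  fullySharing common inclusions =
    nameClashFree common ,
    λ j k x y _ _ → ∼D-preserves-name inclusions

mainTheorem2 : ∀ {o h i n s o' h' : Level}
    (C : InclusiveCategoryWithSymbols o h i n s)
    (I : Category o' h') (D : Functor I (InclusiveCategoryWithSymbols.cat C)) →
    DiagramNotions.SharedSymbolsHaveCommonSource C D →
    DiagramNotions.NameClashFree C D ×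
    (DiagramNotions.AllEdgesInclusions C D → DiagramNotions.FullySharing C D)
mainTheorem2 C I D common = nameClashFree common , fullySharing common
  where open SymbolClasses C D
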